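{- For $n\ge 3$, the path $P_n$ with $n$ vertices satisfies $\nu_*(P_n)\le 4n-5$.
   Context: For a finite simple graph $G=(V,E)$ with $p=|V|$, $q=|E|$, $\ell=p+q$, a construction sequence (c-sequence) for $G$ is a bijection $x:\{1,\dots,\ell\}\to V\sqcup E$ such that for every edge $e=uw$, $x^{ -1}(e)>\max\{x^{ -1}(u),x^{ -1}(w)\}$. The cost of an edge $e=uw$ in $x$ is $\nu(e,x)=(x^{ -1}(e)-x^{ -1}(u))+(x^{ -1}(e)-x^{ -1}(w))$, and the cost of $x$ is $\nu(x)=\sum_{e\in E}\nu(e,x)$. The min cost of $G$ is $\nu_*(G)=\min\nu(x)$ over all c-sequences $x$ for $G$. -}

module Defs where

open import Data.Nat using (ℕ; zero; suc; _+_; _*_; _∸_; _<_)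
open import Data.Nat.Properties using (suc-injective; n<1+n; <-irrefl)
open import Data.Fin using (Fin; toℕ; inject₁)
open import Data.Fin.Properties using (toℕ-inject₁; toℕ-injective)
open import Data.List using (map; allFin)
open import Data.Nat.ListAction using (sum)
open import Data.Product using (_×_; _,_; proj₁; proj₂; Σ; ∃)
open import Data.Sum using (_⊎_; inj₁; inj₂)
open import Function.Bundles using (_↔_; Inverse)
open import Relation.Nullary using (¬_)
open import Data.Empty using (⊥-elim)
open import Relation.Binary.PropositionalEquality using (_≡_; refl; sym; trans; cong)

record SimpleGraph : Set where
  field
    p     : ℕ
    q     : ℕ
    ends  : Fin q → Fin p × Fin p
    loopless : ∀ e → ¬ (proj₁ (ends e) ≡ proj₂ (ends e))
    no-multi : ∀ e f →
      (proj₁ (ends e) ≡ proj₁ (ends f) × proj₂ (ends e) ≡ proj₂ (ends f)) ⊎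
      (proj₁ (ends e) ≡ proj₂ (ends f) × proj₂ (ends e) ≡ proj₁ (ends f)) →
      e ≡ f

module _ (G : SimpleGraph) where
  open SimpleGraph G

  Elem : Set
  Elem = Fin p ⊎ Fin q

  -- a bijection x : {1..ℓ} → V ⊔ E (positions are 0-based here; cost is
  -- translation invariant)
  Seq : Set
  Seq = Fin (p + q) ↔ Elem

  pos : Seq → Elem → ℕ
  pos x a = toℕ (Inverse.from x a)

  IsCSeq : Seq → Set
  IsCSeq x = ∀ e → (pos x (inj₁ (proj₁ (ends e))) < pos x (inj₂ e))
                 × (pos x (inj₁ (proj₂ (ends e))) < pos x (inj₂ e))

  edgeCost : Seq → Fin q → ℕ
  edgeCost x e = (pos x (inj₂ e) ∸ pos x (inj₁ (proj₁ (ends e))))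
               + (pos x (inj₂ e) ∸ pos x (inj₁ (proj₂ (ends e))))

  cost : Seq → ℕ
  cost x = sum (map (edgeCost x) (allFin q))

  -- ν_*(G) ≤ k  (the minimum over the finite nonempty set of c-sequences)
  MinCost≤ : ℕ → Set
  MinCost≤ k = Σ Seq λ x → IsCSeq x × cost x Data.Nat.≤ k

private
  pathLoopless : ∀ {m} (e : Fin m) → ¬ (inject₁ e ≡ Fin.suc e)
  pathLoopless e eq = <-irrefl (trans (sym (toℕ-inject₁ e)) (cong toℕ eq)) (n<1+n (toℕ e))

  n≢2+n : ∀ n → ¬ (n ≡ suc (suc n))
  n≢2+n zero ()
  n≢2+n (suc n) eq = n≢2+n n (suc-injective eq)

  pathNoMulti : ∀ {m} (e f : Fin m) →
    (inject₁ e ≡ inject₁ f × Fin.suc e ≡ Fin.suc f) ⊎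
    (inject₁ e ≡ Fin.suc f × Fin.suc e ≡ inject₁ f) → e ≡ f
  pathNoMulti e f (inj₁ (_ , refl)) = refl
  pathNoMulti e f (inj₂ (a , b)) =
    ⊥-elim (n≢2+n (toℕ e)
      (trans (trans (sym (toℕ-inject₁ e)) (cong toℕ a))
             (cong suc (trans (sym (toℕ-inject₁ f)) (sym (cong toℕ b))))))

Path : ℕ → SimpleGraph
Path zero = record { p = 0 ; q = 0 ; ends = λ () ; loopless = λ () ; no-multi = λ () }
Path (suc m) = record
  { p = suc m ; q = m
  ; ends = λ i → inject₁ i , Fin.suc i
  ; loopless = pathLoopless
  ; no-multi = pathNoMulti }

module Submission where

-- Place the vertices and edges of P_n in the order v₀ v₁ e₀ v₂ e₁ … v_{n-1} e_{n-2}.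
-- Every edge e_i then comes right after its endpoint v_{i+1} and three places after v_i,
-- except e₀, which is only two places after v₀. So e₀ costs 2 + 1 = 3, every other edge
-- costs 3 + 1 = 4, and the total is 3 + 4 (n - 2) = 4n - 5.

open import Defs
open import Data.Nat using (ℕ; zero; suc; _+_; _*_; _∸_; _≤_; _<_; z≤n; s≤s)
open import Data.Nat.Properties
  using (+-identityʳ; +-comm; *-comm; *-suc; m+n∸n≡m; n<1+n; n≤1+n; ≤-reflexive; +-monoʳ-≤; *-monoʳ-≤)
open import Data.Nat.Tactic.RingSolver using (solve-∀)
open import Data.Fin using (Fin; toℕ; cast; inject₁; combine)
open import Data.Fin.Patterns using (0F; 1F)
open import Data.Fin.Properties using (+↔⊎; *↔×; toℕ-cast; toℕ-combine; toℕ-inject₁; cast-involutive)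
open import Data.List using (tabulate)
open import Data.List.Properties using (map-tabulate)
open import Data.Nat.ListAction using (sum)
open import Data.Product using (_×_; _,_)
open import Data.Sum using (_⊎_; inj₁; inj₂)
open import Data.Sum.Algebra using (⊎-cong; ⊎-assoc)
open import Function.Base using (_∘_)
open import Function.Bundles using (_↔_; Inverse; mk↔ₛ′)
open import Function.Properties.Inverse using (↔-refl; ↔-sym; ↔-trans)
open import Relation.Binary.PropositionalEquality
  using (_≡_; refl; sym; trans; cong; cong₂; subst; subst₂; module ≡-Reasoning)

sum-tabulate-const : ∀ {k c} (f : Fin k → ℕ) → (∀ i → f i ≡ c) → sum (tabulate f) ≡ k * c
sum-tabulate-const {zero}  f f≡c = refl
sum-tabulate-const {suc k} f f≡c = cong₂ _+_ (f≡c 0F) (sum-tabulate-const (f ∘ Fin.suc) (f≡c ∘ Fin.suc))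

⊎-diag↔×Fin2 : ∀ {a} {A : Set a} → (A ⊎ A) ↔ (A × Fin 2)
⊎-diag↔×Fin2 {A = A} = mk↔ₛ′ tag untag tag∘untag untag∘tag
  where
  tag : A ⊎ A → A × Fin 2
  tag (inj₁ x) = x , 0F
  tag (inj₂ x) = x , 1F
  untag : A × Fin 2 → A ⊎ A
  untag (x , 0F) = inj₁ x
  untag (x , 1F) = inj₂ x
  tag∘untag : ∀ y → tag (untag y) ≡ y
  tag∘untag (x , 0F) = refl
  tag∘untag (x , 1F) = refl
  untag∘tag : ∀ z → untag (tag z) ≡ z
  untag∘tag (inj₁ x) = refl
  untag∘tag (inj₂ x) = refl

cast↔ : ∀ {m n} → m ≡ n → Fin m ↔ Fin n
cast↔ eq = mk↔ₛ′ (cast eq) (cast (sym eq)) (cast-involutive eq (sym eq)) (cast-involutive (sym eq) eq)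

m*2≡m+m : ∀ m → m * 2 ≡ m + m
m*2≡m+m m = trans (*-comm m 2) (cong (m +_) (+-identityʳ m))

-- Fin (suc m) ⊎ Fin m ≅ Fin 1 ⊎ (Fin m × Fin 2) ≅ Fin (1 + 2m), sending
-- v₀ ↦ 0, v_{i+1} ↦ 2i + 1 and e_i ↦ 2i + 2.
interleave : ∀ m → (Fin (suc m) ⊎ Fin m) ↔ Fin (suc m + m)
interleave m =
  ↔-trans (⊎-cong +↔⊎ ↔-refl)
  (↔-trans (⊎-assoc _ (Fin 1) (Fin m) (Fin m))
  (↔-trans (⊎-cong ↔-refl (↔-trans ⊎-diag↔×Fin2 (↔-sym *↔×)))
  (↔-trans (↔-sym +↔⊎)
  (cast↔ (cong suc (m*2≡m+m m))))))

pathSeq : ∀ m → Seq (Path (suc m))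
pathSeq m = ↔-sym (interleave m)

slot : ∀ m → Fin (suc m) ⊎ Fin m → ℕ
slot m a = toℕ (Inverse.to (interleave m) a)

slot-inj₁-suc : ∀ {m} (i : Fin m) → slot m (inj₁ (Fin.suc i)) ≡ 1 + 2 * toℕ i
slot-inj₁-suc i = cong suc (begin
  toℕ (cast _ (combine i 0F))  ≡⟨ toℕ-cast _ (combine i 0F) ⟩
  toℕ (combine i 0F)           ≡⟨ toℕ-combine i 0F ⟩
  2 * toℕ i + 0                ≡⟨ +-identityʳ _ ⟩
  2 * toℕ i                    ∎)
  where open ≡-Reasoning

slot-inj₂ : ∀ {m} (i : Fin m) → slot m (inj₂ i) ≡ 2 + 2 * toℕ i
slot-inj₂ i = cong suc (begin
  toℕ (cast _ (combine i 1F))  ≡⟨ toℕ-cast _ (combine i 1F) ⟩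
  toℕ (combine i 1F)           ≡⟨ toℕ-combine i 1F ⟩
  2 * toℕ i + 1                ≡⟨ +-comm _ 1 ⟩
  1 + 2 * toℕ i                ∎)
  where open ≡-Reasoning

slot-inj₁-inject₁-suc : ∀ {m} (i : Fin m) → slot (suc m) (inj₁ (inject₁ (Fin.suc i))) ≡ 1 + 2 * toℕ i
slot-inj₁-inject₁-suc i = trans (slot-inj₁-suc (inject₁ i)) (cong (λ j → 1 + 2 * j) (toℕ-inject₁ i))

slot-inj₁-inject₁<slot-inj₂ : ∀ {m} (e : Fin m) → slot m (inj₁ (inject₁ e)) < slot m (inj₂ e)
slot-inj₁-inject₁<slot-inj₂ 0F = subst (0 <_) (sym (slot-inj₂ 0F)) (s≤s z≤n)
slot-inj₁-inject₁<slot-inj₂ (Fin.suc i) =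
  subst₂ _<_ (sym (slot-inj₁-inject₁-suc i)) (sym (slot-inj₂ (Fin.suc i)))
    (s≤s (+-monoʳ-≤ 1 (*-monoʳ-≤ 2 (n≤1+n (toℕ i)))))

slot-inj₁-suc<slot-inj₂ : ∀ {m} (e : Fin m) → slot m (inj₁ (Fin.suc e)) < slot m (inj₂ e)
slot-inj₁-suc<slot-inj₂ e = subst₂ _<_ (sym (slot-inj₁-suc e)) (sym (slot-inj₂ e)) (n<1+n _)

pathSeq-isCSeq : ∀ m → IsCSeq (Path (suc m)) (pathSeq m)
pathSeq-isCSeq m e = slot-inj₁-inject₁<slot-inj₂ e , slot-inj₁-suc<slot-inj₂ e

module _ (m : ℕ) where
  private
    G = Path (suc (suc m))
    x = pathSeq (suc m)

  pathSeq-edgeCost-first : edgeCost G x 0F ≡ 3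
  pathSeq-edgeCost-first = cong₂ _+_ (cong (_∸ 0) (slot-inj₂ 0F)) (cong₂ _∸_ (slot-inj₂ 0F) (slot-inj₁-suc {suc m} 0F))

  pathSeq-edgeCost-suc : ∀ i → edgeCost G x (Fin.suc i) ≡ 4
  pathSeq-edgeCost-suc i = begin
    (slot (suc m) (inj₂ e) ∸ slot (suc m) (inj₁ (inject₁ e)))
      + (slot (suc m) (inj₂ e) ∸ slot (suc m) (inj₁ (Fin.suc e)))
      ≡⟨ cong₂ _+_ (cong₂ _∸_ (slot-inj₂ e) (slot-inj₁-inject₁-suc i))
                   (cong₂ _∸_ (slot-inj₂ e) (slot-inj₁-suc e)) ⟩
    (2 + 2 * suc j ∸ (1 + 2 * j)) + (2 + 2 * suc j ∸ (1 + 2 * suc j))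
      ≡⟨ cong (λ k → (2 + k ∸ (1 + 2 * j)) + (2 + 2 * suc j ∸ (1 + 2 * suc j))) (*-suc 2 j) ⟩
    (3 + (1 + 2 * j) ∸ (1 + 2 * j)) + (1 + (1 + 2 * suc j) ∸ (1 + 2 * suc j))
      ≡⟨ cong₂ _+_ (m+n∸n≡m 3 (1 + 2 * j)) (m+n∸n≡m 1 (1 + 2 * suc j)) ⟩
    3 + 1 ∎
    where
    open ≡-Reasoning
    e = Fin.suc i
    j = toℕ i

  pathSeq-cost : cost G x ≡ 3 + m * 4
  pathSeq-cost = cong₂ _+_ pathSeq-edgeCost-first
    (trans (cong sum (map-tabulate Fin.suc (edgeCost G x))) (sum-tabulate-const _ pathSeq-edgeCost-suc))

4*[2+m]≡3+m*4+5 : ∀ m → 4 * (2 + m) ≡ 3 + m * 4 + 5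
4*[2+m]≡3+m*4+5 = solve-∀

pathSeq-cost≡4n∸5 : ∀ m → cost (Path (2 + m)) (pathSeq (suc m)) ≡ 4 * (2 + m) ∸ 5
pathSeq-cost≡4n∸5 m = begin
  cost (Path (2 + m)) (pathSeq (suc m))  ≡⟨ pathSeq-cost m ⟩
  3 + m * 4                              ≡⟨ m+n∸n≡m (3 + m * 4) 5 ⟨
  3 + m * 4 + 5 ∸ 5                      ≡⟨ cong (_∸ 5) (4*[2+m]≡3+m*4+5 m) ⟨
  4 * (2 + m) ∸ 5                        ∎
  where open ≡-Reasoning

-- The construction also covers n = 2; the hypothesis is only needed to rule out n = 1.
theorem9 : ∀ (n : ℕ) → 3 ≤ n → MinCost≤ (Path n) (4 * n ∸ 5)
theorem9 (suc (suc m)) _ = pathSeq (suc m) , pathSeq-isCSeq (suc m) , ≤-reflexive (pathSeq-cost≡4n∸5 m)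
theorem9 1 (s≤s ())
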